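{- Let $\phi$ be an $\mathsf{LTL}_f$ formula. After each iteration of the main loop of $\mathsf{CDLSC}$ on input $\phi$ in which no model is found, the current sequence of frames $\mathcal{C}$ (with each frame $\mathcal{C}[i]$ read as the set of states $s$ of $T_\phi$ such that $c\subseteq s$ for some $c\in\mathcal{C}[i]$) is a conflict sequence for $T_\phi$.
   Context: $\mathsf{LTL}_f$ is linear temporal logic over finite nonempty traces. $Tail$ holds exactly at the last position of a trace. $\mathrm{xnf}(\psi)$ is the neXt normal form of $\psi$ (equivalent to $\psi$, temporal subformulas only under $\mathsf{X}$); $\mathrm{xnf}(s)=\bigwedge_{\psi\in s}\mathrm{xnf}(\psi)$; $\theta^p$ is the propositional abstraction treating each $\mathsf{X}\chi$ (and $Tail$) as a Boolean variable. $T_\phi$: states are finite sets of formulas, initial state $s_0=\{\phi\}$, and $s\to s'$ iff some satisfying assignment $A$ of $\mathrm{xnf}(s)^p$ has $s'=X(A):=\{\chi:\mathsf{X}\chi\text{ true in }A\}$ ($s'$ is a one-transition next state of $s$). A state $s$ is final iff $Tail\wedge\mathrm{xnf}(s)^p$ is satisfiable. A conflict sequence for $T_\phi$ is a finite nonempty sequence $\mathcal{C}[0],\ldots,\mathcal{C}[|\mathcal{C}|-1]$ of sets of states with: (1) $s_0\in\mathcal{C}[i]$ for all $i$; (2) no state in $\mathcal{C}[0]$ is final; (3) for $0\le i<|\mathcal{C}|-1$, every one-transition next state of every $s\in\mathcal{C}[i+1]$ is in $\mathcal{C}[i]$. $\neg\mathsf{X}(\mathcal{C}[i])$ denotes $\neg\bigvee_{c\in\mathcal{C}[i]}\bigwedge_{\psi\in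 c}\mathsf{X}\psi$. $get\_uc()$: after an unsatisfiable query $(\mathrm{xnf}(s)\wedge\theta)^p$, returns $c\subseteq s$ with $(\bigwedge_{\psi\in c}\mathrm{xnf}(\psi)\wedge\theta)^p$ still unsatisfiable. Algorithm $\mathsf{CDLSC}(\phi)$: if $Tail\wedge\mathrm{xnf}(\phi)^p$ is satisfiable, return SAT. Otherwise set $\mathcal{C}[0]:=\{\{\phi\}\}$, $k:=0$, and loop (each pass is an iteration): if $try\_satisfy(\phi,k)$ returns true, return SAT (a model is found); if $inv\_found(k)$ returns true, return UNSAT; set $k:=k+1$ and $\mathcal{C}[k]:=\emptyset$. Procedure $try\_satisfy(\psi_0,\ell)$: while $(\neg\mathsf{X}(\mathcal{C}[\ell])\wedge\mathrm{xnf}(\psi_0))^p$ is satisfiable with model $A$: let $\psi'=X(A)$; if $\ell=0$: if $Tail\wedge\mathrm{xnf}(\psi')^p$ is satisfiable return true, else add $get\_uc()$ to $\mathcal{C}[0]$ and continue; if $\ell>0$ and $try\_satisfy(\psi',\ell-1)$ returns true, return true. After the loop exits, add $get\_uc()$ (from the last unsatisfiable query) to $\mathcal{C}[\ell+1]$ and return false. Procedure $inv\_found(k)$ returns true iff for some frame level $i$ the Boolean implication $\bigwedge_{j\le i}\mathcal{C}[j]\Rightarrow\mathcal{C}[i+1]$ is valid. -}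

module Defs where

open import Data.Nat using (ℕ; zero; suc; _≤_; _<_; _≟_)
open import Data.Bool using (Bool; true; false; not; _∧_; _∨_; if_then_else_)
open import Data.List using (List; []; _∷_; map; foldr)
open import Data.List.Membership.Propositional using (_∈_)
open import Data.List.Relation.Unary.Any using (Any)
open import Data.List.Relation.Unary.All using (All)
open import Data.Product using (Σ; _×_; ∃)
open import Relation.Nullary using (¬_; yes; no)
open import Relation.Binary.PropositionalEquality using (_≡_)

-- LTLf formulas in negation normal form (atoms are natural numbers)

data Formula : Set where
  tt ff      : Formula
  atom natom : ℕ → Formula
  _∧ᶠ_ _∨ᶠ_  : Formula → Formula → Formula
  Xᶠ Nᶠ      : Formula → Formula        -- strong next, weak next
  _Uᶠ_ _Rᶠ_  : Formula → Formula → Formula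

-- States of T_φ: finite sets of formulas, represented by lists
-- (only membership matters everywhere below).
State : Set
State = List Formula

_⊆ˢ_ : State → State → Set
c ⊆ˢ s = ∀ {ψ} → ψ ∈ c → ψ ∈ s

data Var : Set where
  pv   : ℕ → Var
  nxt  : Formula → Var
  tail : Var

data PForm : Set where
  ⊤ᵖ ⊥ᵖ : PForm
  var   : Var → PForm
  ¬ᵖ_   : PForm → PForm
  _∧ᵖ_ _∨ᵖ_ : PForm → PForm → PForm

Assignment : Set
Assignment = Var → Bool

eval : Assignment → PForm → Bool
eval A ⊤ᵖ = true
eval A ⊥ᵖ = false
eval A (var v) = A v
eval A (¬ᵖ f) = not (eval A f)
eval A (f ∧ᵖ g) = eval A f ∧ eval A g
eval A (f ∨ᵖ g) = eval A f ∨ eval A g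

Sat : PForm → Set
Sat f = Σ Assignment λ A → eval A f ≡ true

conjᵖ : List PForm → PForm
conjᵖ = foldr _∧ᵖ_ ⊤ᵖ

disjᵖ : List PForm → PForm
disjᵖ = foldr _∨ᵖ_ ⊥ᵖ

-- xnf(ψ)^p : neXt normal form, directly in propositional abstraction

xnf : Formula → PForm
xnf tt = ⊤ᵖ
xnf ff = ⊥ᵖ
xnf (atom p) = var (pv p)
xnf (natom p) = ¬ᵖ var (pv p)
xnf (φ ∧ᶠ ψ) = xnf φ ∧ᵖ xnf ψ
xnf (φ ∨ᶠ ψ) = xnf φ ∨ᵖ xnf ψ
xnf (Xᶠ φ) = (¬ᵖ var tail) ∧ᵖ var (nxt φ)
xnf (Nᶠ φ) = var tail ∨ᵖ var (nxt φ)
xnf (φ Uᶠ ψ) = xnf ψ ∨ᵖ (xnf φ ∧ᵖ ((¬ᵖ var tail) ∧ᵖ var (nxt (φ Uᶠ ψ))))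
xnf (φ Rᶠ ψ) = xnf ψ ∧ᵖ (xnf φ ∨ᵖ (var tail ∨ᵖ var (nxt (φ Rᶠ ψ))))

xnfS : State → PForm
xnfS s = conjᵖ (map xnf s)

data OccX (χ : Formula) : PForm → Set where
  here : OccX χ (var (nxt χ))
  neg  : ∀ {f} → OccX χ f → OccX χ (¬ᵖ f)
  ∧l   : ∀ {f g} → OccX χ f → OccX χ (f ∧ᵖ g)
  ∧r   : ∀ {f g} → OccX χ g → OccX χ (f ∧ᵖ g)
  ∨l   : ∀ {f g} → OccX χ f → OccX χ (f ∨ᵖ g)
  ∨r   : ∀ {f g} → OccX χ g → OccX χ (f ∨ᵖ g)

IsXOf : Assignment → PForm → State → Set
IsXOf A f s' = ∀ χ → (χ ∈ s' → OccX χ f × A (nxt χ) ≡ true)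
                   × (OccX χ f → A (nxt χ) ≡ true → χ ∈ s')

Trans : State → State → Set
Trans s s' = Σ Assignment λ A → eval A (xnfS s) ≡ true × IsXOf A (xnfS s) s'

Final : State → Set
Final s = Sat (var tail ∧ᵖ xnfS s)

-- Conflict sequence C[0..n] (length n+1) of sets of states, for T_φ
-- (initial state s₀ = {φ}).
record ConflictSeq (φ : Formula) (n : ℕ) (C : ℕ → State → Set) : Set where
  field
    initIn   : ∀ i → i ≤ n → C i (φ ∷ [])
    noFinal  : ∀ s → C 0 s → ¬ Final s
    backward : ∀ i → i < n → ∀ s s' → C (suc i) s → Trans s s' → C i s'

-- A frame is a list of clauses (sets of formulas); frames indexed by ℕ,
-- frames not yet created are empty.
Frames : Set
Frames = ℕ → List State

⟦_⟧ : Frames → ℕ → State → Set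
⟦ C ⟧ i s = Any (λ c → c ⊆ˢ s) (C i)

addFrame : Frames → ℕ → State → Frames
addFrame C i c j with j ≟ i
... | yes _ = c ∷ C j
... | no  _ = C j

negX : List State → PForm
negX cs = ¬ᵖ disjᵖ (map (λ c → conjᵖ (map (λ ψ → var (nxt ψ)) c)) cs)

initFrames : Formula → Frames
initFrames φ zero = (φ ∷ []) ∷ []
initFrames φ (suc _) = []

-- Big-step relational semantics of try_satisfy(ψ₀, ℓ):
--   TrySat C ψ₀ ℓ r C'  : started with frames C, it may return r, leaving frames C'.
-- Nondeterminism: any model A of the SAT query, any valid unsat core c.
data TrySat : Frames → State → ℕ → Bool → Frames → Set where
  exit   : ∀ {C ψ₀ ℓ c} →
           ¬ Sat (negX (C ℓ) ∧ᵖ xnfS ψ₀) →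
           c ⊆ˢ ψ₀ → ¬ Sat (xnfS c ∧ᵖ negX (C ℓ)) →
           TrySat C ψ₀ ℓ false (addFrame C (suc ℓ) c)
  found0 : ∀ {C ψ₀ A ψ'} →
           eval A (negX (C 0) ∧ᵖ xnfS ψ₀) ≡ true →
           IsXOf A (negX (C 0) ∧ᵖ xnfS ψ₀) ψ' →
           Sat (var tail ∧ᵖ xnfS ψ') →
           TrySat C ψ₀ 0 true C
  block0 : ∀ {C ψ₀ A ψ' c r C'} →
           eval A (negX (C 0) ∧ᵖ xnfS ψ₀) ≡ true →
           IsXOf A (negX (C 0) ∧ᵖ xnfS ψ₀) ψ' →
           ¬ Sat (var tail ∧ᵖ xnfS ψ') →
           c ⊆ˢ ψ' → ¬ Sat (xnfS c ∧ᵖ var tail) →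
           TrySat (addFrame C 0 c) ψ₀ 0 r C' →
           TrySat C ψ₀ 0 r C'
  foundS : ∀ {C ψ₀ m A ψ' C'} →
           eval A (negX (C (suc m)) ∧ᵖ xnfS ψ₀) ≡ true →
           IsXOf A (negX (C (suc m)) ∧ᵖ xnfS ψ₀) ψ' →
           TrySat C ψ' m true C' →
           TrySat C ψ₀ (suc m) true C'
  recS   : ∀ {C ψ₀ m A ψ' C' r C''} →
           eval A (negX (C (suc m)) ∧ᵖ xnfS ψ₀) ≡ true →
           IsXOf A (negX (C (suc m)) ∧ᵖ xnfS ψ₀) ψ' →
           TrySat C ψ' m false C' →
           TrySat C' ψ₀ (suc m) r C'' →
           TrySat C ψ₀ (suc m) r C''

-- Boolean reading of a frame (formulas as Boolean variables)
BoolFrame : (Formula → Bool) → List State → Set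
BoolFrame v cs = Any (λ c → All (λ ψ → v ψ ≡ true) c) cs

InvFound : Frames → ℕ → Set
InvFound C k = Σ ℕ λ i → i ≤ k ×
  (∀ (v : Formula → Bool) → (∀ j → j ≤ i → BoolFrame v (C j)) → BoolFrame v (C (suc i)))

-- Configurations (k, C) at the start of a main-loop iteration of CDLSC(φ)
-- reachable without returning.
data AtIteration (φ : Formula) : ℕ → Frames → Set where
  start : ¬ Sat (var tail ∧ᵖ xnf φ) → AtIteration φ 0 (initFrames φ)
  step  : ∀ {k C C'} → AtIteration φ k C →
          TrySat C (φ ∷ []) k false C' → ¬ InvFound C' k →
          AtIteration φ (suc k) C'

module Submission where

-- Call a clause c stored in frame j
-- *sound* if it justifies its place there: for j = 0 no state covering c
-- is final, and for j+1 every successor of a state covering c lies in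
-- frame j.  Frames only ever grow, so sound clauses stay sound; and every
-- clause that try_satisfy adds is an unsatisfiable core, which is sound by
-- two facts about the propositional abstraction ('core-nonfinal' and
-- 'core-blocks').  The latter needs that every transition s → s' is
-- witnessed by an assignment making no next-variable true outside s'
-- ('transition-model'); building it requires decidable equality of
-- formulas, obtained by encoding formulas as binary trees.  Finally a
-- failing call try_satisfy(φ, k) puts {φ} into frame k+1, so by induction
-- over the iterations {φ} lies in every frame, and sound frames containing
-- {φ} are exactly a conflict sequence.

open import Defs
open import Data.Nat using (ℕ; zero; suc; _≤_; s≤s) renaming (_≟_ to _≟ℕ_)
open import Data.Nat.Properties using (m≤n⇒m<n∨m≡n)
open import Data.Bool using (true; false; not; _∧_; _∨_)
open import Data.Bool.Properties using (not-injective)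
open import Data.List using ([]; _∷_; map)
open import Data.List.Membership.Propositional using (_∈_; find; lose)
open import Data.List.Relation.Binary.Subset.Propositional using (_⊆_)
open import Data.List.Relation.Binary.Subset.Propositional.Properties using (Any-resp-⊆)
open import Data.List.Relation.Unary.Any using (Any; here; there)
open import Data.Product using (Σ; _×_; _,_; proj₁; proj₂; uncurry)
open import Data.Sum using (_⊎_; inj₁; inj₂)
open import Relation.Nullary using (¬_; Dec; does; yes; no; contradiction)
open import Relation.Nullary.Decidable using (map′; _×-dec_)
open import Relation.Binary.PropositionalEquality
  using (_≡_; refl; sym; trans; cong; cong₂; module ≡-Reasoning)

-- Decidable equality of formulas, via an injective encoding into binary
-- trees of naturals (which have an evident decidable equality).

data Code : Set where
  leaf : ℕ → Code
  node : Code → Code → Code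

_≟ᶜ_ : (a b : Code) → Dec (a ≡ b)
leaf m ≟ᶜ leaf n = map′ (cong leaf) (λ { refl → refl }) (m ≟ℕ n)
node a b ≟ᶜ node c d =
  map′ (uncurry (cong₂ node)) (λ { refl → refl , refl }) ((a ≟ᶜ c) ×-dec (b ≟ᶜ d))
leaf _ ≟ᶜ node _ _ = no (λ ())
node _ _ ≟ᶜ leaf _ = no (λ ())

encode : Formula → Code
encode tt = leaf 0
encode ff = leaf 1
encode (atom p) = node (leaf 2) (leaf p)
encode (natom p) = node (leaf 3) (leaf p)
encode (φ ∧ᶠ ψ) = node (leaf 4) (node (encode φ) (encode ψ))
encode (φ ∨ᶠ ψ) = node (leaf 5) (node (encode φ) (encode ψ))
encode (Xᶠ φ) = node (leaf 6) (encode φ)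
encode (Nᶠ φ) = node (leaf 7) (encode φ)
encode (φ Uᶠ ψ) = node (leaf 8) (node (encode φ) (encode ψ))
encode (φ Rᶠ ψ) = node (leaf 9) (node (encode φ) (encode ψ))

-- A left inverse of 'encode'; codes outside its image are sent to tt.
decode : Code → Formula
decode (leaf 1) = ff
decode (node (leaf 2) (leaf p)) = atom p
decode (node (leaf 3) (leaf p)) = natom p
decode (node (leaf 4) (node a b)) = decode a ∧ᶠ decode b
decode (node (leaf 5) (node a b)) = decode a ∨ᶠ decode b
decode (node (leaf 6) a) = Xᶠ (decode a)
decode (node (leaf 7) a) = Nᶠ (decode a)
decode (node (leaf 8) (node a b)) = decode a Uᶠ decode b
decode (node (leaf 9) (node a b)) = decode a Rᶠ decode b
decode _ = tt

decode-encode : ∀ φ → decode (encode φ) ≡ φ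
decode-encode tt = refl
decode-encode ff = refl
decode-encode (atom p) = refl
decode-encode (natom p) = refl
decode-encode (φ ∧ᶠ ψ) = cong₂ _∧ᶠ_ (decode-encode φ) (decode-encode ψ)
decode-encode (φ ∨ᶠ ψ) = cong₂ _∨ᶠ_ (decode-encode φ) (decode-encode ψ)
decode-encode (Xᶠ φ) = cong Xᶠ (decode-encode φ)
decode-encode (Nᶠ φ) = cong Nᶠ (decode-encode φ)
decode-encode (φ Uᶠ ψ) = cong₂ _Uᶠ_ (decode-encode φ) (decode-encode ψ)
decode-encode (φ Rᶠ ψ) = cong₂ _Rᶠ_ (decode-encode φ) (decode-encode ψ)

encode-injective : ∀ {φ ψ} → encode φ ≡ encode ψ → φ ≡ ψ
encode-injective {φ} {ψ} eq = begin
  φ                 ≡⟨ sym (decode-encode φ) ⟩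
  decode (encode φ) ≡⟨ cong decode eq ⟩
  decode (encode ψ) ≡⟨ decode-encode ψ ⟩
  ψ                 ∎
  where open ≡-Reasoning

_≟ᶠ_ : (φ ψ : Formula) → Dec (φ ≡ ψ)
φ ≟ᶠ ψ = map′ encode-injective (cong encode) (encode φ ≟ᶜ encode ψ)

open import Data.List.Membership.DecPropositional _≟ᶠ_ using (_∈?_)

∧-true : ∀ {a b} → a ∧ b ≡ true → a ≡ true × b ≡ true
∧-true {true} {true} _ = refl , refl

true-∧ : ∀ {a b} → a ≡ true → b ≡ true → a ∧ b ≡ true
true-∧ refl refl = refl

conj-true : ∀ {I : Set} A (g : I → PForm) xs →
            eval A (conjᵖ (map g xs)) ≡ true → ∀ {x} → x ∈ xs → eval A (g x) ≡ true
conj-true A g (x ∷ xs) e (here refl) = proj₁ (∧-true e)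
conj-true A g (x ∷ xs) e (there x∈xs) = conj-true A g xs (proj₂ (∧-true e)) x∈xs

true-conj : ∀ {I : Set} A (g : I → PForm) xs →
            (∀ {x} → x ∈ xs → eval A (g x) ≡ true) → eval A (conjᵖ (map g xs)) ≡ true
true-conj A g [] _ = refl
true-conj A g (x ∷ xs) h = true-∧ (h (here refl)) (true-conj A g xs (λ m → h (there m)))

disj-true : ∀ {I : Set} A (g : I → PForm) xs →
            eval A (disjᵖ (map g xs)) ≡ true → Any (λ x → eval A (g x) ≡ true) xs
disj-true A g (x ∷ xs) e with eval A (g x) in gx
... | true = here gx
... | false = there (disj-true A g xs e)

xnfS-antitone : ∀ A {c s} → c ⊆ˢ s → eval A (xnfS s) ≡ true → eval A (xnfS c) ≡ true
xnfS-antitone A {c} {s} c⊆s e = true-conj A xnf c (λ m → conj-true A xnf s e (c⊆s m))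

eval-local : ∀ A B → (∀ n → B (pv n) ≡ A (pv n)) → B tail ≡ A tail →
             ∀ f → (∀ χ → OccX χ f → B (nxt χ) ≡ A (nxt χ)) → eval B f ≡ eval A f
eval-local A B hp ht ⊤ᵖ h = refl
eval-local A B hp ht ⊥ᵖ h = refl
eval-local A B hp ht (var (pv n)) h = hp n
eval-local A B hp ht (var (nxt χ)) h = h χ here
eval-local A B hp ht (var tail) h = ht
eval-local A B hp ht (¬ᵖ f) h = cong not (eval-local A B hp ht f (λ χ o → h χ (neg o)))
eval-local A B hp ht (f ∧ᵖ g) h =
  cong₂ _∧_ (eval-local A B hp ht f (λ χ o → h χ (∧l o))) (eval-local A B hp ht g (λ χ o → h χ (∧r o)))
eval-local A B hp ht (f ∨ᵖ g) h =
  cong₂ _∨_ (eval-local A B hp ht f (λ χ o → h χ (∨l o))) (eval-local A B hp ht g (λ χ o → h χ (∨r o)))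

restrictNext : Assignment → State → Assignment
restrictNext A s' (nxt χ) = does (χ ∈? s')
restrictNext A s' v = A v

restrictNext-agrees : ∀ A f s' → IsXOf A f s' → ∀ χ → OccX χ f → restrictNext A s' (nxt χ) ≡ A (nxt χ)
restrictNext-agrees A f s' X χ o with χ ∈? s'
... | yes χ∈s' = sym (proj₂ (proj₁ (X χ) χ∈s'))
... | no χ∉s' with A (nxt χ) in Aχ
...   | true = contradiction (proj₂ (X χ) o Aχ) χ∉s'
...   | false = refl

restrictNext-true : ∀ A s' χ → restrictNext A s' (nxt χ) ≡ true → χ ∈ s'
restrictNext-true A s' χ e with χ ∈? s'
... | yes χ∈s' = χ∈s'

transition-model : ∀ {s s'} → Trans s s' →
                   Σ Assignment λ B → eval B (xnfS s) ≡ true × (∀ χ → B (nxt χ) ≡ true → χ ∈ s')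
transition-model {s} {s'} (A , A⊨s , X) = restrictNext A s' , B⊨s , restrictNext-true A s'
  where
  B⊨s : eval (restrictNext A s') (xnfS s) ≡ true
  B⊨s = trans (eval-local A (restrictNext A s') (λ _ → refl) refl (xnfS s) (restrictNext-agrees A (xnfS s) s' X)) A⊨s

core-nonfinal : ∀ {c s} → c ⊆ˢ s → ¬ Sat (xnfS c ∧ᵖ var tail) → ¬ Final s
core-nonfinal c⊆s unsat (A , e) =
  unsat (A , true-∧ (xnfS-antitone A c⊆s (proj₂ (∧-true e))) (proj₁ (∧-true e)))

core-blocks : ∀ {c s s'} D → c ⊆ˢ s → Trans s s' → ¬ Sat (xnfS c ∧ᵖ negX D) →
              Any (λ d → d ⊆ˢ s') D
core-blocks {c} {s} {s'} D c⊆s t unsat with transition-model {s} {s'} t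
... | B , B⊨s , B⊆s' = covered (disj-true B nextConj D (not-injective negX-false))
  where
  nextConj : State → PForm
  nextConj d = conjᵖ (map (λ ψ → var (nxt ψ)) d)

  negX-false : eval B (negX D) ≡ false
  negX-false with eval B (negX D) in e
  ... | false = refl
  ... | true with unsat (B , true-∧ (xnfS-antitone B c⊆s B⊨s) e)
  ...   | ()

  covered : ∀ {E} → Any (λ d → eval B (nextConj d) ≡ true) E → Any (λ d → d ⊆ˢ s') E
  covered (here e) = here (λ {ψ} ψ∈d → B⊆s' ψ (conj-true B (λ ψ → var (nxt ψ)) _ e ψ∈d))
  covered (there a) = there (covered a)

_⊑_ : Frames → Frames → Set
C ⊑ C' = ∀ i → C i ⊆ C' i

⊑-trans : ∀ {C D E} → C ⊑ D → D ⊑ E → C ⊑ E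
⊑-trans C⊑D D⊑E i m = D⊑E i (C⊑D i m)

⟦⟧-mono : ∀ {C C'} → C ⊑ C' → ∀ i {s} → ⟦ C ⟧ i s → ⟦ C' ⟧ i s
⟦⟧-mono C⊑C' i = Any-resp-⊆ (C⊑C' i)

addFrame-grows : ∀ C i c → C ⊑ addFrame C i c
addFrame-grows C i c j m with j ≟ℕ i
... | yes _ = there m
... | no _ = m

addFrame-new : ∀ C i c → c ∈ addFrame C i c i
addFrame-new C i c with i ≟ℕ i
... | yes _ = here refl
... | no i≢i with i≢i refl
...   | ()

addFrame-cases : ∀ C i c j {d} → d ∈ addFrame C i c j → (j ≡ i × d ≡ c) ⊎ d ∈ C j
addFrame-cases C i c j m with j ≟ℕ i
addFrame-cases C i c j (here refl) | yes j≡i = inj₁ (j≡i , refl)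
addFrame-cases C i c j (there m) | yes _ = inj₂ m
... | no _ = inj₂ m

Sound : Frames → ℕ → State → Set
Sound C zero c = ∀ s → c ⊆ˢ s → ¬ Final s
Sound C (suc j) c = ∀ s s' → c ⊆ˢ s → Trans s s' → ⟦ C ⟧ j s'

SoundFrames : Frames → Set
SoundFrames C = ∀ j {c} → c ∈ C j → Sound C j c

Sound-mono : ∀ {C C'} → C ⊑ C' → ∀ j {c} → Sound C j c → Sound C' j c
Sound-mono C⊑C' zero h = h
Sound-mono C⊑C' (suc j) h s s' c⊆s t = ⟦⟧-mono C⊑C' j (h s s' c⊆s t)

SoundFrames-add : ∀ C i c → SoundFrames C → Sound (addFrame C i c) i c → SoundFrames (addFrame C i c)
SoundFrames-add C i c sf sc j m with addFrame-cases C i c j m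
... | inj₁ (refl , refl) = sc
... | inj₂ m' = Sound-mono (addFrame-grows C i c) j (sf j m')

trySat-sound : ∀ {C ψ ℓ r C'} → TrySat C ψ ℓ r C' → SoundFrames C → SoundFrames C' × C ⊑ C'
trySat-sound {C} (exit {ℓ = ℓ} {c = c} _ _ unsat) sf =
  SoundFrames-add C (suc ℓ) c sf blocks , addFrame-grows C (suc ℓ) c
  where
  blocks : Sound (addFrame C (suc ℓ) c) (suc ℓ) c
  blocks s s' c⊆s t = ⟦⟧-mono (addFrame-grows C (suc ℓ) c) ℓ (core-blocks (C ℓ) c⊆s t unsat)
trySat-sound (found0 _ _ _) sf = sf , λ _ m → m
trySat-sound {C} (block0 {c = c} _ _ _ _ unsat rest) sf
  with trySat-sound rest (SoundFrames-add C 0 c sf (λ s c⊆s → core-nonfinal c⊆s unsat))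
... | sf' , grows = sf' , ⊑-trans (addFrame-grows C 0 c) grows
trySat-sound (foundS _ _ rest) sf = trySat-sound rest sf
trySat-sound (recS _ _ call rest) sf with trySat-sound call sf
... | sf₁ , grows₁ with trySat-sound rest sf₁
... | sf₂ , grows₂ = sf₂ , ⊑-trans grows₁ grows₂

trySat-false-covers : ∀ {C ψ ℓ C'} → TrySat C ψ ℓ false C' → ⟦ C' ⟧ (suc ℓ) ψ
trySat-false-covers {C} (exit {ℓ = ℓ} {c = c} _ c⊆ψ _) = lose (addFrame-new C (suc ℓ) c) c⊆ψ
trySat-false-covers (block0 _ _ _ _ _ rest) = trySat-false-covers rest
trySat-false-covers (recS _ _ _ rest) = trySat-false-covers rest

InitialUpTo : Formula → ℕ → Frames → Set
InitialUpTo φ k C = ∀ i → i ≤ k → ⟦ C ⟧ i (φ ∷ [])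

Invariant : Formula → ℕ → Frames → Set
Invariant φ k C = SoundFrames C × InitialUpTo φ k C

≤-suc-cases : ∀ {i k} → i ≤ suc k → i ≤ k ⊎ i ≡ suc k
≤-suc-cases i≤1+k with m≤n⇒m<n∨m≡n i≤1+k
... | inj₁ (s≤s i≤k) = inj₁ i≤k
... | inj₂ i≡1+k = inj₂ i≡1+k

iteration-step : ∀ {φ k C C'} → Invariant φ k C → TrySat C (φ ∷ []) k false C' →
                 Invariant φ (suc k) C'
iteration-step {φ} {k} {C} {C'} (sf , init) run with trySat-sound run sf
... | sf' , grows = sf' , λ i i≤1+k → covers i (≤-suc-cases i≤1+k)
  where
  covers : ∀ i → i ≤ k ⊎ i ≡ suc k → ⟦ C' ⟧ i (φ ∷ [])
  covers i (inj₁ i≤k) = ⟦⟧-mono grows i (init i i≤k)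
  covers _ (inj₂ refl) = trySat-false-covers run

initial-invariant : ∀ φ → ¬ Sat (var tail ∧ᵖ xnf φ) → Invariant φ 0 (initFrames φ)
initial-invariant φ notFinal = sound , λ { zero _ → here (λ m → m) }
  where
  sound : SoundFrames (initFrames φ)
  sound zero (here refl) s φ⊆s (A , e) =
    notFinal (A , true-∧ (proj₁ (∧-true e)) (conj-true A xnf s (proj₂ (∧-true e)) (φ⊆s (here refl))))

atIteration-invariant : ∀ {φ k C} → AtIteration φ k C → Invariant φ k C
atIteration-invariant {φ} (start notFinal) = initial-invariant φ notFinal
atIteration-invariant (step at run _) = iteration-step (atIteration-invariant at) run

invariant⇒conflictSeq : ∀ {φ n C} → Invariant φ n C → ConflictSeq φ n ⟦ C ⟧
invariant⇒conflictSeq (sf , init) = record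
  { initIn = init
  ; noFinal = λ s covered → let (_ , c∈C₀ , c⊆s) = find covered in sf zero c∈C₀ s c⊆s
  ; backward = λ i _ s s' covered t →
      let (_ , c∈C , c⊆s) = find covered in sf (suc i) c∈C s s' c⊆s t
  }

mainTheorem5 : ∀ (φ : Formula) (k : ℕ) (C C' : Frames) →
    AtIteration φ k C →
    TrySat C (φ ∷ []) k false C' →
    ConflictSeq φ (suc k) ⟦ C' ⟧
mainTheorem5 φ k C C' at run =
  invariant⇒conflictSeq (iteration-step (atIteration-invariant at) run)
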